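{- The set $\{(u,v,w)\in\mathbb{YF}^3:\ w=o(u,v)\}$ is first-order definable in $\mathbf{YF}^*=\langle\mathbb{YF},\geqslant,2\rangle$.
   Context: $\mathbb{YF}$ is the set of all finite words (including the empty word $\varepsilon$) over $\{1,2\}$. For a word $v$, $\#v$ is its length and $d(v)$ the number of letters $2$. Order: write $x=x'w$, $y=y'w$ with $w$ the longest common suffix; then $y\geqslant x$ iff $d(y')\geqslant\#x'$. $\mathbf{YF}^*$ is this partial order with an added constant symbol interpreted as the word $2$. A relation is first-order definable if there is a first-order formula in the language $\{\geqslant,2\}$ whose set of satisfying tuples is exactly the relation. The vertex $o(u,v)$: write $u=u'w$, $v=v'w$ with $w$ the longest common suffix; assume $\#u\geqslant\#v$ (otherwise exchange roles of $u$ and $v$); then $o(u,v)$ is obtained from $u$ by replacing its first (leftmost) $\max(\#v'-d(u'),0)$ letters $1$ by $2$. -}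

module Defs where

open import Data.Nat using (ℕ; zero; suc; _≤_; _∸_; _≤ᵇ_)
open import Data.Bool using (Bool; true; false; if_then_else_)
open import Data.List using (List; []; _∷_; length; reverse)
open import Data.Product using (_×_; _,_; Σ; proj₁; proj₂)
open import Data.Sum using (_⊎_)
open import Data.Unit using (⊤)
open import Data.Empty using (⊥)
open import Data.Fin using (Fin; zero; suc)
open import Data.Vec using (Vec; []; _∷_; lookup)
open import Relation.Binary.PropositionalEquality using (_≡_)
open import Function.Bundles using (_⇔_)

data Letter : Set where
  one two : Letter

-- the set 𝕐𝔽: finite words over {1,2}, written left to right
Word : Set
Word = List Letter

len : Word → ℕ
len = length

d : Word → ℕ
d []         = 0
d (one ∷ v)  = d v
d (two ∷ v)  = suc (d v)

word2 : Word
word2 = two ∷ []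

stripCommon : Word → Word → Word × Word
stripCommon (one ∷ a) (one ∷ b) = stripCommon a b
stripCommon (two ∷ a) (two ∷ b) = stripCommon a b
stripCommon a b = a , b

-- x = x' w, y = y' w with w the longest common suffix; returns (x', y')
heads : Word → Word → Word × Word
heads x y with stripCommon (reverse x) (reverse y)
... | a , b = reverse a , reverse b

_≽_ : Word → Word → Set
y ≽ x = len (proj₁ (heads x y)) ≤ d (proj₂ (heads x y))

-- replace the first (leftmost) k letters 1 by 2
-- (if fewer than k letters 1 exist, all of them are replaced)
replace1 : ℕ → Word → Word
replace1 zero    u         = u
replace1 (suc k) []        = []
replace1 (suc k) (one ∷ u) = two ∷ replace1 k u
replace1 (suc k) (two ∷ u) = two ∷ replace1 (suc k) u

-- o(u,v) assuming #u ≥ #v : u' = heads-part of u, v' = heads-part of v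
oAux : Word → Word → Word
oAux u v = replace1 (len (proj₂ (heads u v)) ∸ d (proj₁ (heads u v))) u
  -- max(#v' - d(u'), 0) is truncated subtraction on ℕ

o : Word → Word → Word
o u v = if len v ≤ᵇ len u then oAux u v else oAux v u

-- terms with n free variables (de Bruijn indices)
data Term (n : ℕ) : Set where
  var  : Fin n → Term n
  cTwo : Term n

data Formula : ℕ → Set where
  tt ff     : ∀ {n} → Formula n
  _≐_       : ∀ {n} → Term n → Term n → Formula n
  _≥'_      : ∀ {n} → Term n → Term n → Formula n
  ¬'_       : ∀ {n} → Formula n → Formula n
  _∧'_ _∨'_ _⇒'_ : ∀ {n} → Formula n → Formula n → Formula n
  ∀' ∃'     : ∀ {n} → Formula (suc n) → Formula n

evalT : ∀ {n} → Vec Word n → Term n → Word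
evalT ρ (var i) = lookup ρ i
evalT ρ cTwo    = word2

Sat : ∀ {n} → Vec Word n → Formula n → Set
Sat ρ tt        = ⊤
Sat ρ ff        = ⊥
Sat ρ (s ≐ t)   = evalT ρ s ≡ evalT ρ t
Sat ρ (s ≥' t)  = evalT ρ s ≽ evalT ρ t
Sat ρ (¬' φ)    = Sat ρ φ → ⊥
Sat ρ (φ ∧' ψ)  = Sat ρ φ × Sat ρ ψ
Sat ρ (φ ∨' ψ)  = Sat ρ φ ⊎ Sat ρ ψ
Sat ρ (φ ⇒' ψ)  = Sat ρ φ → Sat ρ ψ
Sat ρ (∀' φ)    = (x : Word) → Sat (x ∷ ρ) φ
Sat ρ (∃' φ)    = Σ Word λ x → Sat (x ∷ ρ) φ

Definable : (n : ℕ) → (Vec Word n → Set) → Set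
Definable n R = Σ (Formula n) λ φ → (ρ : Vec Word n) → Sat ρ φ ⇔ R ρ

oGraph : Vec Word 3 → Set
oGraph (u ∷ v ∷ w ∷ []) = w ≡ o u v

-- o(u,v) is the least upper bound of u and v for ≽, so its graph is defined by "w lies
-- above u and v, and below every word that lies above u and v". Two facts about ≽ carry the proof: a comparison y ≽ x may be witnessed by any
-- common suffix, since stripping further common letters only improves #x' ≤ d(y'); and
-- over a common suffix whose heads end in different letters, any witness already forces
-- the bound for those heads. Turning the first #v' ∸ d(u') letters 1 of u into 2 is then
-- the cheapest way to lift d(u') to #v' while staying above u.
module Submission where

open import Defs
open import Data.Nat using (ℕ; zero; suc; _+_; _∸_; _≤_; _≤ᵇ_; z≤n; s≤s; s≤s⁻¹)
open import Data.Bool using (true; false)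
open import Data.Nat.Properties
open import Data.List using ([]; _∷_; _++_; [_]; reverse; replicate; head; last)
open import Data.List.Properties
open import Data.Maybe using (just)
open import Data.Product using (_×_; _,_; proj₁; proj₂; swap; ∃; ∃₂)
open import Data.Sum using (_⊎_; inj₁; inj₂)
open import Data.Empty using (⊥; ⊥-elim)
open import Data.Fin using (#_)
open import Data.Vec using ([]; _∷_)
open import Relation.Nullary.Reflects using (ofʸ; ofⁿ)
open import Relation.Binary.PropositionalEquality hiding ([_])
open import Function.Bundles using (_⇔_; mk⇔; Equivalence)

d-++ : ∀ a b → d (a ++ b) ≡ d a + d b
d-++ []        b = refl
d-++ (one ∷ a) b = d-++ a b
d-++ (two ∷ a) b = cong suc (d-++ a b)

d≤len : ∀ a → d a ≤ len a
d≤len []        = z≤n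
d≤len (one ∷ a) = m≤n⇒m≤1+n (d≤len a)
d≤len (two ∷ a) = s≤s (d≤len a)

d-reverse : ∀ a → d (reverse a) ≡ d a
d-reverse []      = refl
d-reverse (c ∷ a) = begin
  d (reverse (c ∷ a))     ≡⟨ cong d (unfold-reverse c a) ⟩
  d (reverse a ++ [ c ])  ≡⟨ d-++ (reverse a) [ c ] ⟩
  d (reverse a) + d [ c ] ≡⟨ cong (_+ d [ c ]) (d-reverse a) ⟩
  d a + d [ c ]           ≡⟨ +-comm (d a) (d [ c ]) ⟩
  d [ c ] + d a           ≡⟨ d-++ [ c ] a ⟨
  d (c ∷ a)               ∎
  where open ≡-Reasoning

twos : ℕ → Word
twos n = replicate n two

d-twos : ∀ n → d (twos n) ≡ n
d-twos zero    = refl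
d-twos (suc n) = cong suc (d-twos n)

∸-+-bound : ∀ l a b c → l ≤ c + b → a ≤ c → l ∸ (a + b) + a ≤ c
∸-+-bound l a b c l≤c+b a≤c with ≤-total l (a + b)
... | inj₁ l≤a+b rewrite m≤n⇒m∸n≡0 l≤a+b = a≤c
... | inj₂ a+b≤l = +-cancelʳ-≤ b _ c (begin
  l ∸ (a + b) + a + b   ≡⟨ +-assoc (l ∸ (a + b)) a b ⟩
  l ∸ (a + b) + (a + b) ≡⟨ m∸n+n≡m a+b≤l ⟩
  l                     ≤⟨ l≤c+b ⟩
  c + b                 ∎)
  where open ≤-Reasoning

++-split : ∀ (a s b t : Word) → a ++ s ≡ b ++ t →
           (∃ λ m → b ≡ a ++ m × s ≡ m ++ t) ⊎ (∃₂ λ c m → a ≡ b ++ c ∷ m × t ≡ c ∷ m ++ s)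
++-split []      s b        t eq = inj₁ (b , refl , eq)
++-split (c ∷ a) s []       t eq = inj₂ (c , a , refl , sym eq)
++-split (c ∷ a) s (c′ ∷ b) t eq with ∷-injective eq
... | refl , eq′ with ++-split a s b t eq′
...   | inj₁ (m , b≡ , s≡)     = inj₁ (m , cong (c ∷_) b≡ , s≡)
...   | inj₂ (e , m , a≡ , t≡) = inj₂ (e , m , cong (c ∷_) a≡ , t≡)

DifferentFirst : Word → Word → Set
DifferentFirst a b = ∀ {c} → head a ≡ just c → head b ≡ just c → ⊥

DifferentLast : Word → Word → Set
DifferentLast x y = ∀ {c} → last x ≡ just c → last y ≡ just c → ⊥

last-++-∷ : ∀ (a : Word) c m → last (a ++ c ∷ m) ≡ last (c ∷ m)
last-++-∷ []          c m = refl
last-++-∷ (e ∷ [])    c m = refl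
last-++-∷ (e ∷ f ∷ a) c m = last-++-∷ (f ∷ a) c m

last-∷-just : ∀ (c : Letter) m → ∃ λ e → last (c ∷ m) ≡ just e
last-∷-just c []      = c , refl
last-∷-just c (f ∷ m) = last-∷-just f m

last-reverse : ∀ (a : Word) → last (reverse a) ≡ head a
last-reverse []      = refl
last-reverse (c ∷ a) = trans (cong last (unfold-reverse c a)) (last-++-∷ (reverse a) c [])

differentFirst⇒differentLast-reverse : ∀ {a b} → DifferentFirst a b → DifferentLast (reverse a) (reverse b)
differentFirst⇒differentLast-reverse {a} {b} apart ra rb =
  apart (trans (sym (last-reverse a)) ra) (trans (sym (last-reverse b)) rb)

differentLast-commonSuffix : ∀ a b c m → DifferentLast (a ++ c ∷ m) (b ++ c ∷ m) → ⊥
differentLast-commonSuffix a b c m apart with last-∷-just c m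
... | e , last≡ = apart (trans (last-++-∷ a c m) last≡) (trans (last-++-∷ b c m) last≡)

differentLast-replaceˡ : ∀ U Z c m {y} → DifferentLast (U ++ c ∷ m) y → DifferentLast (Z ++ c ∷ m) y
differentLast-replaceˡ U Z c m apart Z≡ =
  apart (trans (last-++-∷ U c m) (trans (sym (last-++-∷ Z c m)) Z≡))

stripCommon-prefix : ∀ A B → ∃ λ p → A ≡ p ++ proj₁ (stripCommon A B) × B ≡ p ++ proj₂ (stripCommon A B)
stripCommon-prefix []        B         = [] , refl , refl
stripCommon-prefix (one ∷ a) []        = [] , refl , refl
stripCommon-prefix (one ∷ a) (one ∷ b) with stripCommon-prefix a b
... | p , a≡ , b≡ = one ∷ p , cong (one ∷_) a≡ , cong (one ∷_) b≡
stripCommon-prefix (one ∷ a) (two ∷ b) = [] , refl , refl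
stripCommon-prefix (two ∷ a) []        = [] , refl , refl
stripCommon-prefix (two ∷ a) (one ∷ b) = [] , refl , refl
stripCommon-prefix (two ∷ a) (two ∷ b) with stripCommon-prefix a b
... | p , a≡ , b≡ = two ∷ p , cong (two ∷_) a≡ , cong (two ∷_) b≡

stripCommon-differentFirst : ∀ A B → DifferentFirst (proj₁ (stripCommon A B)) (proj₂ (stripCommon A B))
stripCommon-differentFirst []        B         () _
stripCommon-differentFirst (one ∷ a) []        _ ()
stripCommon-differentFirst (one ∷ a) (one ∷ b) = stripCommon-differentFirst a b
stripCommon-differentFirst (one ∷ a) (two ∷ b) refl ()
stripCommon-differentFirst (two ∷ a) []        _ ()
stripCommon-differentFirst (two ∷ a) (one ∷ b) refl ()
stripCommon-differentFirst (two ∷ a) (two ∷ b) = stripCommon-differentFirst a b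

stripCommon-++ : ∀ P A B → stripCommon (P ++ A) (P ++ B) ≡ stripCommon A B
stripCommon-++ []        A B = refl
stripCommon-++ (one ∷ P) A B = stripCommon-++ P A B
stripCommon-++ (two ∷ P) A B = stripCommon-++ P A B

stripCommon-swap : ∀ A B → stripCommon B A ≡ swap (stripCommon A B)
stripCommon-swap []        []        = refl
stripCommon-swap []        (one ∷ b) = refl
stripCommon-swap []        (two ∷ b) = refl
stripCommon-swap (one ∷ a) []        = refl
stripCommon-swap (one ∷ a) (one ∷ b) = stripCommon-swap a b
stripCommon-swap (one ∷ a) (two ∷ b) = refl
stripCommon-swap (two ∷ a) []        = refl
stripCommon-swap (two ∷ a) (one ∷ b) = refl
stripCommon-swap (two ∷ a) (two ∷ b) = stripCommon-swap a b

Len≤d : Word × Word → Set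
Len≤d ab = len (proj₁ ab) ≤ d (proj₂ ab)

stripCommon-preserves-len≤d : ∀ A B → len A ≤ d B → Len≤d (stripCommon A B)
stripCommon-preserves-len≤d []        B         h = h
stripCommon-preserves-len≤d (one ∷ a) []        h = h
stripCommon-preserves-len≤d (one ∷ a) (one ∷ b) h = stripCommon-preserves-len≤d a b (m+n≤o⇒n≤o 1 h)
stripCommon-preserves-len≤d (one ∷ a) (two ∷ b) h = h
stripCommon-preserves-len≤d (two ∷ a) []        h = h
stripCommon-preserves-len≤d (two ∷ a) (one ∷ b) h = h
stripCommon-preserves-len≤d (two ∷ a) (two ∷ b) h = stripCommon-preserves-len≤d a b (s≤s⁻¹ h)

differentFirst-mutually-bounded⇒[] : ∀ a b → DifferentFirst a b → len a ≤ d b → len b ≤ d a → a ≡ [] × b ≡ []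
differentFirst-mutually-bounded⇒[] []        []        _     _     _     = refl , refl
differentFirst-mutually-bounded⇒[] []        (c ∷ b)   _     _     ()
differentFirst-mutually-bounded⇒[] (c ∷ a)   []        _     ()    _
differentFirst-mutually-bounded⇒[] (one ∷ a) (c ∷ b)   _     a≤b   b≤a =
  ⊥-elim (<-irrefl refl (≤-trans a≤b (≤-trans (d≤len (c ∷ b)) (≤-trans b≤a (d≤len a)))))
differentFirst-mutually-bounded⇒[] (two ∷ a) (one ∷ b) _     a≤b   b≤a =
  ⊥-elim (<-irrefl refl (≤-trans b≤a (≤-trans (d≤len (two ∷ a)) (≤-trans a≤b (d≤len b)))))
differentFirst-mutually-bounded⇒[] (two ∷ a) (two ∷ b) apart _     _     = ⊥-elim (apart refl refl)

heads≡reverse-stripCommon : ∀ x y → heads x y ≡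
  (reverse (proj₁ (stripCommon (reverse x) (reverse y))) , reverse (proj₂ (stripCommon (reverse x) (reverse y))))
heads≡reverse-stripCommon x y with stripCommon (reverse x) (reverse y)
... | a , b = refl

heads-suffix : ∀ x y → ∃ λ s → x ≡ proj₁ (heads x y) ++ s × y ≡ proj₂ (heads x y) ++ s
heads-suffix x y rewrite heads≡reverse-stripCommon x y with stripCommon-prefix (reverse x) (reverse y)
... | p , rx≡ , ry≡ = reverse p , reversed rx≡ , reversed ry≡
  where
  reversed : ∀ {z a} → reverse z ≡ p ++ a → z ≡ reverse a ++ reverse p
  reversed {z} {a} eq = trans (sym (reverse-involutive z)) (trans (cong reverse eq) (reverse-++ p a))

heads-differentLast : ∀ x y → DifferentLast (proj₁ (heads x y)) (proj₂ (heads x y))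
heads-differentLast x y rewrite heads≡reverse-stripCommon x y =
  differentFirst⇒differentLast-reverse (stripCommon-differentFirst (reverse x) (reverse y))

≽⇔stripCommon : ∀ x y → y ≽ x ⇔ Len≤d (stripCommon (reverse x) (reverse y))
≽⇔stripCommon x y rewrite heads≡reverse-stripCommon x y with stripCommon (reverse x) (reverse y)
... | a , b = mk⇔ (subst₂ _≤_ (length-reverse a) (d-reverse b)) (subst₂ _≤_ (sym (length-reverse a)) (sym (d-reverse b)))

≽-antisym : ∀ {x y} → y ≽ x → x ≽ y → x ≡ y
≽-antisym {x} {y} y≽x x≽y
  with p , rx≡ , ry≡ ← stripCommon-prefix (reverse x) (reverse y)
  with a≡[] , b≡[] ← differentFirst-mutually-bounded⇒[] _ _ (stripCommon-differentFirst (reverse x) (reverse y))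
         (Equivalence.to (≽⇔stripCommon x y) y≽x)
         (subst Len≤d (stripCommon-swap (reverse x) (reverse y)) (Equivalence.to (≽⇔stripCommon y x) x≽y))
  = reverse-injective (trans rx≡ (trans (cong (p ++_) (trans a≡[] (sym b≡[]))) (sym ry≡)))

-- y ≽ˢ x: y ≽ x witnessed by some common suffix, not necessarily the longest one.
record _≽ˢ_ (y x : Word) : Set where
  constructor witness
  field
    xHead yHead suffix : Word
    x≡ : x ≡ xHead ++ suffix
    y≡ : y ≡ yHead ++ suffix
    len≤d : len xHead ≤ d yHead

≽⇒≽ˢ : ∀ {x y} → y ≽ x → y ≽ˢ x
≽⇒≽ˢ {x} {y} y≽x with heads-suffix x y
... | s , x≡ , y≡ = witness _ _ s x≡ y≡ y≽x

≽ˢ⇒≽ : ∀ {x y} → y ≽ˢ x → y ≽ x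
≽ˢ⇒≽ (witness x′ y′ s refl refl h) = Equivalence.from (≽⇔stripCommon (x′ ++ s) (y′ ++ s))
  (subst Len≤d (sym stripped)
    (stripCommon-preserves-len≤d (reverse x′) (reverse y′) (subst₂ _≤_ (sym (length-reverse x′)) (sym (d-reverse y′)) h)))
  where
  stripped : stripCommon (reverse (x′ ++ s)) (reverse (y′ ++ s)) ≡ stripCommon (reverse x′) (reverse y′)
  stripped = trans (cong₂ stripCommon (reverse-++ x′ s) (reverse-++ y′ s)) (stripCommon-++ (reverse s) (reverse x′) (reverse y′))

≽ˢ-differentLast-bound : ∀ {z Z y′ s} → DifferentLast Z y′ → z ≡ Z ++ s → z ≽ˢ (y′ ++ s) → len y′ ≤ d Z
≽ˢ-differentLast-bound {z} {Z} {y′} {s} apart z≡ (witness V Z₂ s₂ y′s≡ z≡₂ V≤) with ++-split y′ s V s₂ y′s≡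
... | inj₁ (m , refl , refl) = +-cancelʳ-≤ (len m) (len y′) (d Z) (begin
  len y′ + len m  ≡⟨ length-++ y′ ⟨
  len (y′ ++ m)   ≤⟨ V≤ ⟩
  d Z₂            ≡⟨ cong d Z₂≡ ⟩
  d (Z ++ m)      ≡⟨ d-++ Z m ⟩
  d Z + d m       ≤⟨ +-monoʳ-≤ (d Z) (d≤len m) ⟩
  d Z + len m     ∎)
  where
  open ≤-Reasoning
  Z₂≡ : Z₂ ≡ Z ++ m
  Z₂≡ = ++-cancelʳ s₂ Z₂ (Z ++ m) (trans (sym z≡₂) (trans z≡ (sym (++-assoc Z m s₂))))
... | inj₂ (c , m , refl , refl) = ⊥-elim (differentLast-commonSuffix Z₂ V c m (subst (λ t → DifferentLast t y′) Z≡ apart))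
  where
  Z≡ : Z ≡ Z₂ ++ c ∷ m
  Z≡ = ++-cancelʳ s Z (Z₂ ++ c ∷ m) (trans (sym z≡) (trans z≡₂ (sym (++-assoc Z₂ (c ∷ m) s))))

IsJoin : Word → Word → Word → Set
IsJoin x y j = j ≽ x × j ≽ y × (∀ z → z ≽ x × z ≽ y → z ≽ j)

IsJoin-sym : ∀ {x y j} → IsJoin x y j → IsJoin y x j
IsJoin-sym (j≽x , j≽y , least) = j≽y , j≽x , λ z (z≽y , z≽x) → least z (z≽x , z≽y)

IsJoin-unique : ∀ {x y j j′} → IsJoin x y j → IsJoin x y j′ → j ≡ j′
IsJoin-unique {j = j} {j′} (j≽x , j≽y , j-least) (j′≽x , j′≽y , j′-least) =
  ≽-antisym {j} {j′} (j-least j′ (j′≽x , j′≽y)) (j′-least j (j≽x , j≽y))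

-- α is the prefix of a on which replace1 k acts: it contains exactly k letters 1.
record Replace1Split (k : ℕ) (a w : Word) : Set where
  field
    α β : Word
    a≡αβ : a ≡ α ++ β
    len-α : len α ≡ k + d α
    replace1≡ : replace1 k (a ++ w) ≡ twos (len α) ++ β ++ w

replace1-split : ∀ k a w → k + d a ≤ len a → Replace1Split k a w
replace1-split zero    a         w _ = record { α = [] ; β = a ; a≡αβ = refl ; len-α = refl ; replace1≡ = refl }
replace1-split (suc k) (one ∷ a) w (s≤s h) = record
  { α = one ∷ α ; β = β ; a≡αβ = cong (one ∷_) a≡αβ ; len-α = cong suc len-α ; replace1≡ = cong (two ∷_) replace1≡ }
  where open Replace1Split (replace1-split k a w h)
replace1-split (suc k) (two ∷ a) w h = record
  { α = two ∷ α ; β = β ; a≡αβ = cong (two ∷_) a≡αβ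
  ; len-α = trans (cong suc len-α) (sym (+-suc (suc k) (d α))) ; replace1≡ = cong (two ∷_) replace1≡ }
  where open Replace1Split (replace1-split (suc k) a w (s≤s⁻¹ (subst (_≤ suc (len a)) (+-suc (suc k) (d a)) h)))

module Replace1Join (x′ y′ s : Word) (apart : DifferentLast x′ y′) (short : len y′ ≤ len x′) where

  k : ℕ
  k = len y′ ∸ d x′

  k+d≤len : k + d x′ ≤ len x′
  k+d≤len = ≤-trans (+-monoˡ-≤ (d x′) (∸-monoˡ-≤ (d x′) short)) (≤-reflexive (m∸n+n≡m (d≤len x′)))

  open Replace1Split (replace1-split k x′ s k+d≤len)

  x≡ : x′ ++ s ≡ α ++ β ++ s
  x≡ = trans (cong (_++ s) a≡αβ) (++-assoc α β s)

  o′ : Word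
  o′ = twos (len α) ++ β ++ s

  o≽ˢx : o′ ≽ˢ (x′ ++ s)
  o≽ˢx = witness α (twos (len α)) (β ++ s) x≡ refl (≤-reflexive (sym (d-twos (len α))))

  o≽ˢy : o′ ≽ˢ (y′ ++ s)
  o≽ˢy = witness y′ (twos (len α) ++ β) s refl (sym (++-assoc (twos (len α)) β s)) (begin
    len y′                 ≤⟨ m≤n+m∸n (len y′) (d x′) ⟩
    d x′ + k               ≡⟨ +-comm (d x′) k ⟩
    k + d x′               ≡⟨ cong (k +_) (trans (cong d a≡αβ) (d-++ α β)) ⟩
    k + (d α + d β)        ≡⟨ +-assoc k (d α) (d β) ⟨
    k + d α + d β          ≡⟨ cong (_+ d β) (trans (sym len-α) (sym (d-twos (len α)))) ⟩
    d (twos (len α)) + d β ≡⟨ d-++ (twos (len α)) β ⟨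
    d (twos (len α) ++ β)  ∎)
    where open ≤-Reasoning

  -- A witness for z ≽ x whose head U stops strictly inside α: then Z ++ c ∷ m ++ β and y′
  -- still end in different letters, so z ≽ y bounds #y′ and hence #α.
  α-bound : ∀ {z U Z c m} → α ≡ U ++ c ∷ m → len U ≤ d Z → z ≡ (Z ++ c ∷ m ++ β) ++ s → z ≽ˢ (y′ ++ s) →
            len α ≤ d (Z ++ c ∷ m)
  α-bound {U = U} {Z} {c} {m} α≡ U≤ z≡ z≽y = subst (len α ≤_) (sym (d-++ Z (c ∷ m))) (begin
    len α                        ≡⟨ len-α ⟩
    len y′ ∸ d x′ + d α          ≡⟨ cong (λ t → len y′ ∸ t + d α) (trans (cong d a≡αβ) (d-++ α β)) ⟩
    len y′ ∸ (d α + d β) + d α   ≤⟨ ∸-+-bound (len y′) (d α) (d β) (d Z + d (c ∷ m)) y′-bound dα-bound ⟩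
    d Z + d (c ∷ m)              ∎)
    where
    open ≤-Reasoning
    y′-bound : len y′ ≤ d Z + d (c ∷ m) + d β
    y′-bound = subst (len y′ ≤_)
      (trans (d-++ Z (c ∷ m ++ β)) (trans (cong (d Z +_) (d-++ (c ∷ m) β)) (sym (+-assoc (d Z) (d (c ∷ m)) (d β)))))
      (≽ˢ-differentLast-bound {Z = Z ++ c ∷ m ++ β}
        (differentLast-replaceˡ U Z c (m ++ β) {y′}
          (subst (λ t → DifferentLast t y′) (trans a≡αβ (trans (cong (_++ β) α≡) (++-assoc U (c ∷ m) β))) apart))
        z≡ z≽y)
    dα-bound : d α ≤ d Z + d (c ∷ m)
    dα-bound = subst (_≤ d Z + d (c ∷ m)) (sym (trans (cong d α≡) (d-++ U (c ∷ m))))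
      (+-monoˡ-≤ (d (c ∷ m)) (≤-trans (d≤len U) U≤))

  o-least : ∀ {z} → z ≽ˢ (x′ ++ s) → z ≽ˢ (y′ ++ s) → z ≽ˢ o′
  o-least (witness U Z s₁ x≡U z≡ U≤) z≽y with ++-split α (β ++ s) U s₁ (trans (sym x≡) x≡U)
  ... | inj₁ (m , U≡ , βs≡) = witness (twos (len α) ++ m) Z s₁
    (trans (cong (twos (len α) ++_) βs≡) (sym (++-assoc (twos (len α)) m s₁))) z≡
    (subst (_≤ d Z) (trans (cong len U≡) (trans (length-++ α) (sym (trans (length-++ (twos (len α)))
      (cong (_+ len m) (length-replicate (len α))))))) U≤)
  ... | inj₂ (c , m , α≡ , s₁≡) = witness (twos (len α)) (Z ++ c ∷ m) (β ++ s) refl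
    (trans z≡ (trans (cong (Z ++_) s₁≡) (sym (++-assoc Z (c ∷ m) (β ++ s)))))
    (subst (_≤ d (Z ++ c ∷ m)) (sym (length-replicate (len α)))
      (α-bound α≡ U≤ (trans z≡ (trans (cong (Z ++_) (trans s₁≡ (sym (++-assoc (c ∷ m) β s))))
        (sym (++-assoc Z (c ∷ m ++ β) s)))) z≽y))

  isJoin : IsJoin (x′ ++ s) (y′ ++ s) (replace1 k (x′ ++ s))
  isJoin rewrite replace1≡ =
    ≽ˢ⇒≽ o≽ˢx , ≽ˢ⇒≽ o≽ˢy , λ z (z≽x , z≽y) → ≽ˢ⇒≽ (o-least (≽⇒≽ˢ {x′ ++ s} {z} z≽x) (≽⇒≽ˢ {y′ ++ s} {z} z≽y))

oAux-isJoin : ∀ x y → len y ≤ len x → IsJoin x y (oAux x y)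
oAux-isJoin x y y≤x with heads-suffix x y
... | s , x≡ , y≡ = subst₂ (λ a b → IsJoin a b (replace1 (len y′ ∸ d x′) a)) (sym x≡) (sym y≡)
  (Replace1Join.isJoin x′ y′ s (heads-differentLast x y) y′≤x′)
  where
  x′ = proj₁ (heads x y)
  y′ = proj₂ (heads x y)
  y′≤x′ : len y′ ≤ len x′
  y′≤x′ = +-cancelʳ-≤ (len s) (len y′) (len x′)
    (subst₂ _≤_ (trans (cong len y≡) (length-++ y′)) (trans (cong len x≡) (length-++ x′)) y≤x)

o-isJoin : ∀ u v → IsJoin u v (o u v)
o-isJoin u v with len v ≤ᵇ len u | ≤ᵇ-reflects-≤ (len v) (len u)
... | true  | ofʸ v≤u = oAux-isJoin u v v≤u
... | false | ofⁿ v≰u = IsJoin-sym {v} {u} {oAux v u} (oAux-isJoin v u (≰⇒≥ v≰u))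

joinFormula : Formula 3
joinFormula = (var (# 2) ≥' var (# 0)) ∧' ((var (# 2) ≥' var (# 1)) ∧'
  ∀' (((var (# 0) ≥' var (# 1)) ∧' (var (# 0) ≥' var (# 2))) ⇒' (var (# 0) ≥' var (# 3))))

mainTheorem9 : Definable 3 oGraph
mainTheorem9 = joinFormula , λ { (u ∷ v ∷ w ∷ []) →
  mk⇔ (λ w-join → IsJoin-unique {u} {v} w-join (o-isJoin u v)) (λ { refl → o-isJoin u v }) }
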